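{- Let $X$ be an integer-weighted graph that is weakly Hadamard diagonalizable. Then every eigenvalue of the Laplacian matrix $L(X)$ is an integer.
   Context: Graphs are finite, simple and undirected, with edge weights; "integer-weighted" means all edge weights are integers. The adjacency matrix $A(X)$ has $(i,j)$ entry equal to the weight of the edge $ij$ (and $0$ if there is no edge), $D(X)$ is the diagonal matrix of weighted degrees (sum of weights of incident edges), and $L(X)=D(X)-A(X)$. A weak Hadamard matrix is a real square matrix $P$ with entries in $\{ -1,0,1\}$ such that $P^TP$ is tridiagonal. $X$ is weakly Hadamard diagonalizable (WHD) if there is an invertible weak Hadamard matrix $P$ with $P^{ -1}L(X)P$ diagonal. -}

module Defs where

open import Level using (Level)
open import Data.Nat as ℕ using (ℕ; zero; suc)
open import Data.Fin using (Fin; toℕ)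
open import Data.Integer as ℤ using (ℤ; +_; -[1+_])
open import Data.Rational as ℚ using (ℚ; 0ℚ; 1ℚ)
open import Data.Product using (Σ; ∃; _×_; _,_)
open import Data.Sum using (_⊎_)
open import Relation.Binary.PropositionalEquality using (_≡_)
open import Relation.Nullary using (¬_)
open import Algebra.Bundles using (CommutativeRing)

sumℤ : ∀ {n} → (Fin n → ℤ) → ℤ
sumℤ {zero}  f = + 0
sumℤ {suc n} f = f Fin.zero ℤ.+ sumℤ (λ i → f (Fin.suc i))
  where import Data.Fin as Fin

sumℚ : ∀ {n} → (Fin n → ℚ) → ℚ
sumℚ {zero}  f = 0ℚ
sumℚ {suc n} f = f Fin.zero ℚ.+ sumℚ (λ i → f (Fin.suc i))
  where import Data.Fin as Fin

Mat : Set → ℕ → Set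
Mat A n = Fin n → Fin n → A

δ : ∀ {A : Set} {n} → A → A → Fin n → Fin n → A
δ one zer i j with toℕ i ℕ.≟ toℕ j
... | Relation.Nullary.yes _ = one
... | Relation.Nullary.no  _ = zer

transposeℤ : ∀ {n} → Mat ℤ n → Mat ℤ n
transposeℤ M i j = M j i

_·ℤ_ : ∀ {n} → Mat ℤ n → Mat ℤ n → Mat ℤ n
(M ·ℤ N) i k = sumℤ (λ j → M i j ℤ.* N j k)

_·ℚ_ : ∀ {n} → Mat ℚ n → Mat ℚ n → Mat ℚ n
(M ·ℚ N) i k = sumℚ (λ j → M i j ℚ.* N j k)

toℚ : ∀ {n} → Mat ℤ n → Mat ℚ n
toℚ M i j = M i j ℚ./ 1

idℚ : ∀ {n} → Mat ℚ n
idℚ = δ 1ℚ 0ℚ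

-- Integer-weighted (finite, simple, undirected) graphs on vertex set Fin n,
-- given by a symmetric weight matrix with zero diagonal (weight 0 = no edge).

record IntWeightedGraph (n : ℕ) : Set where
  field
    W     : Mat ℤ n
    symm  : ∀ i j → W i j ≡ W j i
    loopless : ∀ i → W i i ≡ + 0

open IntWeightedGraph public

adjacency : ∀ {n} → IntWeightedGraph n → Mat ℤ n
adjacency X = W X

degree : ∀ {n} → IntWeightedGraph n → Fin n → ℤ
degree X i = sumℤ (λ j → W X i j)

degreeMatrix : ∀ {n} → IntWeightedGraph n → Mat ℤ n
degreeMatrix X i j = δ (degree X i) (+ 0) i j

laplacian : ∀ {n} → IntWeightedGraph n → Mat ℤ n
laplacian X i j = degreeMatrix X i j ℤ.- adjacency X i j

IsTridiagonal : ∀ {n} → Mat ℤ n → Set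
IsTridiagonal M = ∀ i j → ℕ.suc (toℕ i) ℕ.< toℕ j ⊎ ℕ.suc (toℕ j) ℕ.< toℕ i → M i j ≡ + 0

IsWeakHadamard : ∀ {n} → Mat ℤ n → Set
IsWeakHadamard P =
  (∀ i j → P i j ≡ + 0 ⊎ P i j ≡ + 1 ⊎ P i j ≡ ℤ.- (+ 1))
  × IsTridiagonal (transposeℤ P ·ℤ P)

IsDiagonalℚ : ∀ {n} → Mat ℚ n → Set
IsDiagonalℚ M = ∀ i j → ¬ (i ≡ j) → M i j ≡ 0ℚ

WHD : ∀ {n} → IntWeightedGraph n → Set
WHD {n} X = Σ (Mat ℤ n) λ P → IsWeakHadamard P ×
  Σ (Mat ℚ n) λ Q → (Q ·ℚ toℚ P ≡ idℚ) × (toℚ P ·ℚ Q ≡ idℚ)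
    × IsDiagonalℚ ((Q ·ℚ toℚ (laplacian X)) ·ℚ toℚ P)

-- Eigenvalues over an integral domain of characteristic zero (e.g. ℂ)

module _ {c ℓ} (R : CommutativeRing c ℓ) where
  open CommutativeRing R

  ιℕ : ℕ → Carrier
  ιℕ zero    = 0#
  ιℕ (suc m) = 1# + ιℕ m

  ι : ℤ → Carrier
  ι (+ m)     = ιℕ m
  ι -[1+ m ]  = - ιℕ (suc m)

  sumR : ∀ {n} → (Fin n → Carrier) → Carrier
  sumR {zero}  f = 0#
  sumR {suc n} f = f Fin.zero + sumR (λ i → f (Fin.suc i))
    where import Data.Fin as Fin

  IsIntegralDomain : Set (c Level.⊔ ℓ)
  IsIntegralDomain = ¬ (1# ≈ 0#) × (∀ x y → x * y ≈ 0# → x ≈ 0# ⊎ y ≈ 0#)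

  HasCharZero : Set ℓ
  HasCharZero = ∀ m → ¬ (ιℕ (suc m) ≈ 0#)

  IsEigenvalue : ∀ {n} → Mat ℤ n → Carrier → Set (c Level.⊔ ℓ)
  IsEigenvalue {n} M λ′ = Σ (Fin n → Carrier) λ v →
    (∃ λ i → ¬ (v i ≈ 0#)) × (∀ i → sumR (λ j → ι (M i j) * v j) ≈ λ′ * v i)

{-# OPTIONS --safe #-}
-- Write D = Q L P, which is diagonal over ℚ, where Q = P⁻¹ and L is the Laplacian.
-- From L P = P D and the fact that every column j of P contains an entry ±1 (P is
-- invertible with entries in {0, ±1}), the entry D_jj is an integer d_j. Scaling Q
-- by a common denominator N gives an integer matrix Q′ with Q′ L = diag(d) Q′ and
-- P Q′ = N I, and these integer identities transfer to any ring R. For an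
-- eigenvector v of L over R, w = Q′ v satisfies d_j w_j = λ w_j, while P w = N v ≠ 0
-- since R has characteristic zero. So some w_j ≠ 0, and λ = d_j as R has no zero
-- divisors.
module Submission where

open import Algebra.Bundles using (CommutativeRing)
open import Data.Empty using (⊥-elim)
open import Data.Fin using (Fin; zero; suc; toℕ; punchIn)
open import Data.Fin.Properties using (punchInᵢ≢i; toℕ-injective; ¬∀⟶∃¬)
open import Data.Integer as ℤ using (ℤ; +_; -[1+_]; _⊖_)
import Data.Integer.Properties as ℤ
open import Data.Nat as ℕ using (ℕ; zero; suc)
import Data.Nat.Properties as ℕ
open import Data.Product as Product using (Σ; ∃; _×_; _,_; proj₁; proj₂)
open import Data.Rational as ℚ using (ℚ; mkℚ)
open import Data.Rational.Literals using (fromℤ)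
import Data.Rational.Properties as ℚ
import Data.Rational.Unnormalised as ℚᵘ
import Data.Rational.Unnormalised.Properties as ℚᵘ
open import Data.Sum as Sum using (_⊎_; inj₁; inj₂)
open import Data.Vec.Functional using (Vector)
open import Function using (_∘_; id)
open import Level using (0ℓ)
import Algebra.Properties.Group as GroupProperties
open import Relation.Binary.Bundles using (Setoid)
open import Relation.Binary.PropositionalEquality as ≡ using (_≡_; _≢_; cong; module ≡-Reasoning)
open import Relation.Nullary using (¬_; yes; no; contradiction)

open import Defs

δ-diag : ∀ {A : Set} {n} (a b : A) (i : Fin n) → δ a b i i ≡ a
δ-diag a b i with toℕ i ℕ.≟ toℕ i
... | yes _  = ≡.refl
... | no i≢i = contradiction ≡.refl i≢i

δ-off : ∀ {A : Set} {n} (a b : A) {i j : Fin n} → i ≢ j → δ a b i j ≡ b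
δ-off a b {i} {j} i≢j with toℕ i ℕ.≟ toℕ j
... | yes i≡j = contradiction (toℕ-injective i≡j) i≢j
... | no _    = ≡.refl

∀⊎⇒∃⊎∀ : ∀ {a b n} {A : Fin n → Set a} {B : Fin n → Set b} →
  (∀ i → A i ⊎ B i) → ∃ A ⊎ (∀ i → B i)
∀⊎⇒∃⊎∀ {n = zero}  A⊎B = inj₂ λ ()
∀⊎⇒∃⊎∀ {n = suc n} A⊎B with A⊎B zero | ∀⊎⇒∃⊎∀ (A⊎B ∘ suc)
... | inj₁ a | _            = inj₁ (zero , a)
... | inj₂ _ | inj₁ (i , a) = inj₁ (suc i , a)
... | inj₂ b | inj₂ bs      = inj₂ λ where
  zero    → b
  (suc i) → bs i

common-multiple : ∀ {p n} (P : Fin n → ℕ → Set p) → (∀ i M {N} → P i N → P i (M ℕ.* N)) →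
  (∀ i → ∃ λ m → P i (suc m)) → ∃ λ m → ∀ i → P i (suc m)
common-multiple {n = zero}  P closed witness = 0 , λ ()
common-multiple {n = suc n} P closed witness
  with witness zero | common-multiple (P ∘ suc) (closed ∘ suc) (witness ∘ suc)
... | m₀ , P₀ | m , Pₛ = m ℕ.+ m₀ ℕ.* suc m , λ where
  zero    → ≡.subst (P zero) (ℕ.*-comm (suc m) (suc m₀)) (closed zero (suc m) P₀)
  (suc i) → closed (suc i) (suc m₀) (Pₛ i)

unit-square : ∀ {z} → z ≡ + 0 ⊎ z ≡ + 1 ⊎ z ≡ ℤ.- (+ 1) → z ≢ + 0 → z ℤ.* z ≡ + 1
unit-square (inj₁ z≡0)           z≢0 = contradiction z≡0 z≢0
unit-square (inj₂ (inj₁ ≡.refl)) _   = ≡.refl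
unit-square (inj₂ (inj₂ ≡.refl)) _   = ≡.refl

module Sums {c ℓ} (R : CommutativeRing c ℓ) where
  open CommutativeRing R hiding (zero)
  open import Algebra.Properties.Semiring.Sum semiring public
  open import Relation.Binary.Reasoning.Setoid setoid

  sumR≡sum : ∀ {n} (f : Vector Carrier n) → sumR R f ≡ sum f
  sumR≡sum {zero}  f = ≡.refl
  sumR≡sum {suc n} f = cong (λ s → f zero + s) (sumR≡sum (f ∘ suc))

  sum-zero : ∀ {n} (f : Vector Carrier n) → (∀ i → f i ≈ 0#) → sum f ≈ 0#
  sum-zero {n} f f≈0 = trans (sum-cong-≋ f≈0) (sum-replicate-zero n)

  sum-single : ∀ {n} (i : Fin n) (f : Vector Carrier n) → (∀ j → i ≢ j → f j ≈ 0#) → sum f ≈ f i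
  sum-single {suc n} i f f≈0 = begin
    sum f                      ≈⟨ sum-remove f ⟩
    f i + sum (f ∘ punchIn i)  ≈⟨ +-congˡ (sum-zero _ λ j → f≈0 _ (punchInᵢ≢i i j ∘ ≡.sym)) ⟩
    f i + 0#                   ≈⟨ +-identityʳ (f i) ⟩
    f i                        ∎

module IntegerEmbedding {c ℓ} (R : CommutativeRing c ℓ) where
  open CommutativeRing R hiding (zero)
  open Sums R
  open import Algebra.Properties.Semiring.Mult semiring as Mult using (×-homo-+; ×1-homo-*)
  open import Algebra.Properties.Ring ring using (-‿distribʳ-*; -0#≈0#; -‿involutive; -‿+-comm)
  open import Algebra.Properties.Quasigroup (GroupProperties.quasigroup +-group) using (x≈z//y)
  open import Algebra.Properties.CommutativeSemigroup +-commutativeSemigroup using (x∙yz≈y∙xz)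
  open import Relation.Binary.Reasoning.Setoid setoid

  ιℕ≡×1 : ∀ m → ιℕ R m ≡ m Mult.× 1#
  ιℕ≡×1 zero    = ≡.refl
  ιℕ≡×1 (suc m) = cong (λ x → 1# + x) (ιℕ≡×1 m)

  ιℕ-homo-+ : ∀ m n → ιℕ R (m ℕ.+ n) ≈ ιℕ R m + ιℕ R n
  ιℕ-homo-+ m n rewrite ιℕ≡×1 (m ℕ.+ n) | ιℕ≡×1 m | ιℕ≡×1 n = ×-homo-+ 1# m n

  ιℕ-homo-* : ∀ m n → ιℕ R (m ℕ.* n) ≈ ιℕ R m * ιℕ R n
  ιℕ-homo-* m n rewrite ιℕ≡×1 (m ℕ.* n) | ιℕ≡×1 m | ιℕ≡×1 n = ×1-homo-* m n

  ι-⊖+ιℕ : ∀ m n → ι R (m ⊖ n) + ιℕ R n ≈ ιℕ R m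
  ι-⊖+ιℕ m       zero    rewrite ℤ.⊖-≥ (ℕ.z≤n {m}) = +-identityʳ (ιℕ R m)
  ι-⊖+ιℕ zero    (suc n) = -‿inverseˡ (ιℕ R (suc n))
  ι-⊖+ιℕ (suc m) (suc n) rewrite ℤ.[1+m]⊖[1+n]≡m⊖n m n =
    trans (x∙yz≈y∙xz (ι R (m ⊖ n)) 1# (ιℕ R n)) (+-congˡ (ι-⊖+ιℕ m n))

  ι-⊖ : ∀ m n → ι R (m ⊖ n) ≈ ιℕ R m - ιℕ R n
  ι-⊖ m n = x≈z//y (ι R (m ⊖ n)) (ιℕ R n) (ιℕ R m) (ι-⊖+ιℕ m n)

  ι-homo-+ : ∀ i j → ι R (i ℤ.+ j) ≈ ι R i + ι R j
  ι-homo-+ (+ m)    (+ n)    = ιℕ-homo-+ m n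
  ι-homo-+ (+ m)    -[1+ n ] = ι-⊖ m (suc n)
  ι-homo-+ -[1+ m ] (+ n)    = trans (ι-⊖ n (suc m)) (+-comm (ιℕ R n) (- ιℕ R (suc m)))
  ι-homo-+ -[1+ m ] -[1+ n ] = begin
    - ιℕ R (suc (suc (m ℕ.+ n)))       ≡⟨ cong (λ k → - ιℕ R (suc k)) (ℕ.+-suc m n) ⟨
    - ιℕ R (suc m ℕ.+ suc n)           ≈⟨ -‿cong (ιℕ-homo-+ (suc m) (suc n)) ⟩
    - (ιℕ R (suc m) + ιℕ R (suc n))    ≈⟨ -‿+-comm (ιℕ R (suc m)) (ιℕ R (suc n)) ⟨
    - ιℕ R (suc m) + - ιℕ R (suc n)    ∎

  ι-homo‿- : ∀ i → ι R (ℤ.- i) ≈ - ι R i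
  ι-homo‿- (+ zero)  = sym -0#≈0#
  ι-homo‿- (+ suc n) = refl
  ι-homo‿- -[1+ n ]  = sym (-‿involutive (ιℕ R (suc n)))

  ι-homo-*ℕ : ∀ i n → ι R (i ℤ.* + n) ≈ ι R i * ιℕ R n
  ι-homo-*ℕ i zero    = begin
    ι R (i ℤ.* + 0)  ≡⟨ cong (ι R) (ℤ.*-zeroʳ i) ⟩
    0#               ≈⟨ zeroʳ (ι R i) ⟨
    ι R i * 0#       ∎
  ι-homo-*ℕ i (suc n) = begin
    ι R (i ℤ.* + suc n)            ≡⟨ cong (ι R) (ℤ.*-suc i (+ n)) ⟩
    ι R (i ℤ.+ i ℤ.* + n)          ≈⟨ ι-homo-+ i (i ℤ.* + n) ⟩
    ι R i + ι R (i ℤ.* + n)        ≈⟨ +-cong (sym (*-identityʳ (ι R i))) (ι-homo-*ℕ i n) ⟩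
    ι R i * 1# + ι R i * ιℕ R n    ≈⟨ distribˡ (ι R i) 1# (ιℕ R n) ⟨
    ι R i * ιℕ R (suc n)           ∎

  ι-homo-* : ∀ i j → ι R (i ℤ.* j) ≈ ι R i * ι R j
  ι-homo-* i (+ n)    = ι-homo-*ℕ i n
  ι-homo-* i -[1+ n ] = begin
    ι R (i ℤ.* -[1+ n ])             ≡⟨ cong (ι R) (ℤ.neg-distribʳ-* i (+ suc n)) ⟨
    ι R (ℤ.- (i ℤ.* + suc n))        ≈⟨ ι-homo‿- (i ℤ.* + suc n) ⟩
    - ι R (i ℤ.* + suc n)            ≈⟨ -‿cong (ι-homo-*ℕ i (suc n)) ⟩
    - (ι R i * ιℕ R (suc n))         ≈⟨ -‿distribʳ-* (ι R i) (ιℕ R (suc n)) ⟩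
    ι R i * - ιℕ R (suc n)           ∎

  ι-homo-sumℤ : ∀ {n} (f : Fin n → ℤ) → ι R (sumℤ f) ≈ sum (ι R ∘ f)
  ι-homo-sumℤ {zero}  f = refl
  ι-homo-sumℤ {suc n} f =
    trans (ι-homo-+ (f zero) (sumℤ (f ∘ suc))) (+-congˡ (ι-homo-sumℤ (f ∘ suc)))

module Matrices {c ℓ} (R : CommutativeRing c ℓ) where
  open CommutativeRing R hiding (zero)
  open Sums R
  open IntegerEmbedding R
  open import Algebra.Properties.CommutativeSemigroup *-commutativeSemigroup using (x∙yz≈y∙xz)
  open import Relation.Binary.Reasoning.Setoid setoid

  Matrix : ℕ → Set c
  Matrix n = Fin n → Fin n → Carrier

  matrix-setoid : ℕ → Setoid c ℓ
  matrix-setoid n = record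
    { Carrier       = Matrix n
    ; _≈_           = λ A B → ∀ i j → A i j ≈ B i j
    ; isEquivalence = record
      { refl  = λ _ _ → refl
      ; sym   = λ A≋B i j → sym (A≋B i j)
      ; trans = λ A≋B B≋C i j → trans (A≋B i j) (B≋C i j)
      }
    }

  module ≋ᴹ {n} = Setoid (matrix-setoid n)

  infix  4 _≋ᴹ_
  infixl 7 _⊗_ _⊛_
  infixr 8 _·ᴹ_

  _≋ᴹ_ : ∀ {n} → Matrix n → Matrix n → Set ℓ
  _≋ᴹ_ {n} = Setoid._≈_ (matrix-setoid n)

  _⊗_ : ∀ {n} → Matrix n → Matrix n → Matrix n
  (A ⊗ B) i k = sum λ j → A i j * B j k

  _⊛_ : ∀ {n} → Matrix n → Vector Carrier n → Vector Carrier n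
  (A ⊛ v) i = sum λ j → A i j * v j

  _·ᴹ_ : ∀ {n} → Carrier → Matrix n → Matrix n
  (a ·ᴹ A) i j = a * A i j

  ⟦_⟧ : ∀ {n} → Mat ℤ n → Matrix n
  ⟦ M ⟧ i j = ι R (M i j)

  IsDiagonal : ∀ {n} → Matrix n → Set ℓ
  IsDiagonal D = ∀ i j → i ≢ j → D i j ≈ 0#

  IsIdentity : ∀ {n} → Matrix n → Set ℓ
  IsIdentity I = IsDiagonal I × (∀ i → I i i ≈ 1#)

  row-matrix-column-assoc : ∀ {n} (a : Vector Carrier n) (B : Matrix n) (c : Vector Carrier n) →
    sum (λ j → sum (λ l → a l * B l j) * c j) ≈ sum (λ l → a l * sum (λ j → B l j * c j))
  row-matrix-column-assoc a B c = begin
    sum (λ j → sum (λ l → a l * B l j) * c j)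
      ≈⟨ sum-cong-≋ (λ j → *-distribʳ-sum (c j) (λ l → a l * B l j)) ⟩
    sum (λ j → sum (λ l → a l * B l j * c j))
      ≈⟨ ∑-comm (λ j l → a l * B l j * c j) ⟩
    sum (λ l → sum (λ j → a l * B l j * c j))
      ≈⟨ sum-cong-≋ (λ l → sum-cong-≋ (λ j → *-assoc (a l) (B l j) (c j))) ⟩
    sum (λ l → sum (λ j → a l * (B l j * c j)))
      ≈⟨ sum-cong-≋ (λ l → *-distribˡ-sum (a l) (λ j → B l j * c j)) ⟨
    sum (λ l → a l * sum (λ j → B l j * c j))
      ∎

  ⊗-assoc : ∀ {n} (A B C : Matrix n) → (A ⊗ B) ⊗ C ≋ᴹ A ⊗ (B ⊗ C)
  ⊗-assoc A B C i k = row-matrix-column-assoc (A i) B (λ j → C j k)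

  ⊛-assoc : ∀ {n} (A B : Matrix n) v i → ((A ⊗ B) ⊛ v) i ≈ (A ⊛ (B ⊛ v)) i
  ⊛-assoc A B v i = row-matrix-column-assoc (A i) B v

  ⊗-cong : ∀ {n} {A A′ B B′ : Matrix n} → A ≋ᴹ A′ → B ≋ᴹ B′ → A ⊗ B ≋ᴹ A′ ⊗ B′
  ⊗-cong A≋A′ B≋B′ i k = sum-cong-≋ λ j → *-cong (A≋A′ i j) (B≋B′ j k)

  ⊗-congˡ : ∀ {n} (A : Matrix n) {B B′} → B ≋ᴹ B′ → A ⊗ B ≋ᴹ A ⊗ B′
  ⊗-congˡ A = ⊗-cong (≋ᴹ.refl {x = A})

  ⊗-congʳ : ∀ {n} (B : Matrix n) {A A′} → A ≋ᴹ A′ → A ⊗ B ≋ᴹ A′ ⊗ B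
  ⊗-congʳ B A≋A′ = ⊗-cong A≋A′ (≋ᴹ.refl {x = B})

  ⊛-congˡ : ∀ {n} {A B : Matrix n} → A ≋ᴹ B → ∀ v i → (A ⊛ v) i ≈ (B ⊛ v) i
  ⊛-congˡ A≋B v i = sum-cong-≋ λ j → *-congʳ (A≋B i j)

  ⊛-congʳ : ∀ {n} (A : Matrix n) {u v : Vector Carrier n} → (∀ j → u j ≈ v j) →
    ∀ i → (A ⊛ u) i ≈ (A ⊛ v) i
  ⊛-congʳ A u≈v i = sum-cong-≋ λ j → *-congˡ (u≈v j)

  ⊛-*ʳ : ∀ {n} a (A : Matrix n) v i → (A ⊛ (λ j → a * v j)) i ≈ a * (A ⊛ v) i
  ⊛-*ʳ a A v i = begin
    sum (λ j → A i j * (a * v j))  ≈⟨ sum-cong-≋ (λ j → x∙yz≈y∙xz (A i j) a (v j)) ⟩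
    sum (λ j → a * (A i j * v j))  ≈⟨ *-distribˡ-sum a (λ j → A i j * v j) ⟨
    a * (A ⊛ v) i                  ∎

  ⊛-row-* : ∀ {n} (A B : Matrix n) a v i → (∀ j → A i j ≈ a * B i j) →
    (A ⊛ v) i ≈ a * (B ⊛ v) i
  ⊛-row-* A B a v i Aᵢ≈aBᵢ = begin
    sum (λ j → A i j * v j)
      ≈⟨ sum-cong-≋ (λ j → trans (*-congʳ (Aᵢ≈aBᵢ j)) (*-assoc a (B i j) (v j))) ⟩
    sum (λ j → a * (B i j * v j))
      ≈⟨ *-distribˡ-sum a (λ j → B i j * v j) ⟨
    a * (B ⊛ v) i
      ∎

  ⊗-diagonalˡ : ∀ {n} {D : Matrix n} → IsDiagonal D → ∀ A → D ⊗ A ≋ᴹ λ i k → D i i * A i k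
  ⊗-diagonalˡ D-diag A i k =
    sum-single i _ λ j i≢j → trans (*-congʳ (D-diag i j i≢j)) (zeroˡ (A j k))

  ⊗-diagonalʳ : ∀ {n} {D : Matrix n} → IsDiagonal D → ∀ A → A ⊗ D ≋ᴹ λ i k → A i k * D k k
  ⊗-diagonalʳ D-diag A i k =
    sum-single k _ λ j k≢j → trans (*-congˡ (D-diag j k (k≢j ∘ ≡.sym))) (zeroʳ (A i j))

  ⊗-identityˡ : ∀ {n} {I : Matrix n} → IsIdentity I → ∀ A → I ⊗ A ≋ᴹ A
  ⊗-identityˡ (I-diag , I≈1) A i k =
    trans (⊗-diagonalˡ I-diag A i k) (trans (*-congʳ (I≈1 i)) (*-identityˡ (A i k)))

  ⊗-identityʳ : ∀ {n} {I : Matrix n} → IsIdentity I → ∀ A → A ⊗ I ≋ᴹ A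
  ⊗-identityʳ (I-diag , I≈1) A i k =
    trans (⊗-diagonalʳ I-diag A i k) (trans (*-congˡ (I≈1 k)) (*-identityʳ (A i k)))

  ·ᴹ-⊗ : ∀ {n} a (A B : Matrix n) → a ·ᴹ A ⊗ B ≋ᴹ a ·ᴹ (A ⊗ B)
  ·ᴹ-⊗ a A B i k = ⊛-row-* (a ·ᴹ A) A a (λ j → B j k) i (λ _ → refl)

  ⊗-·ᴹ : ∀ {n} a (A B : Matrix n) → A ⊗ a ·ᴹ B ≋ᴹ a ·ᴹ (A ⊗ B)
  ⊗-·ᴹ a A B i k = ⊛-*ʳ a A (λ j → B j k) i

  ⟦⟧-homo-⊗ : ∀ {n} (A B : Mat ℤ n) → ⟦ A ·ℤ B ⟧ ≋ᴹ ⟦ A ⟧ ⊗ ⟦ B ⟧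
  ⟦⟧-homo-⊗ A B i k =
    trans (ι-homo-sumℤ λ j → A i j ℤ.* B j k) (sum-cong-≋ λ j → ι-homo-* (A i j) (B j k))

module Diagonalization {c ℓ} (S : CommutativeRing c ℓ) where
  open CommutativeRing S hiding (zero)
  open Sums S
  open IntegerEmbedding S
  open Matrices S

  intertwineʳ : ∀ {n} {P Q I : Matrix n} → IsIdentity I → P ⊗ Q ≋ᴹ I →
    ∀ A → A ⊗ P ≋ᴹ P ⊗ (Q ⊗ A ⊗ P)
  intertwineʳ {P = P} {Q} {I} I-id PQ≋I A = begin
    A ⊗ P                ≈⟨ ⊗-identityˡ I-id (A ⊗ P) ⟨
    I ⊗ (A ⊗ P)          ≈⟨ ⊗-congʳ (A ⊗ P) PQ≋I ⟨
    P ⊗ Q ⊗ (A ⊗ P)      ≈⟨ ⊗-assoc P Q (A ⊗ P) ⟩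
    P ⊗ (Q ⊗ (A ⊗ P))    ≈⟨ ⊗-congˡ P (⊗-assoc Q A P) ⟨
    P ⊗ (Q ⊗ A ⊗ P)      ∎
    where open import Relation.Binary.Reasoning.Setoid (matrix-setoid _)

  intertwineˡ : ∀ {n} {P Q I : Matrix n} → IsIdentity I → P ⊗ Q ≋ᴹ I →
    ∀ A → Q ⊗ A ≋ᴹ Q ⊗ A ⊗ P ⊗ Q
  intertwineˡ {P = P} {Q} {I} I-id PQ≋I A = begin
    Q ⊗ A                ≈⟨ ⊗-identityʳ I-id (Q ⊗ A) ⟨
    Q ⊗ A ⊗ I            ≈⟨ ⊗-congˡ (Q ⊗ A) PQ≋I ⟨
    Q ⊗ A ⊗ (P ⊗ Q)      ≈⟨ ⊗-assoc (Q ⊗ A) P Q ⟨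
    Q ⊗ A ⊗ P ⊗ Q        ∎
    where open import Relation.Binary.Reasoning.Setoid (matrix-setoid _)

  diagonal-entry-integral : ∀ {n} (L P : Mat ℤ n) {D : Matrix n} → IsDiagonal D →
    ⟦ L ⟧ ⊗ ⟦ P ⟧ ≋ᴹ ⟦ P ⟧ ⊗ D → ∀ {p j} → P p j ℤ.* P p j ≡ + 1 →
    D j j ≈ ι S (P p j ℤ.* (L ·ℤ P) p j)
  diagonal-entry-integral L P {D} D-diag LP≋PD {p} {j} s²≡1 = sym (begin
    ι S (s ℤ.* (L ·ℤ P) p j)     ≈⟨ ι-homo-* s ((L ·ℤ P) p j) ⟩
    ι S s * ι S ((L ·ℤ P) p j)   ≈⟨ *-congˡ (⟦⟧-homo-⊗ L P p j) ⟩
    ι S s * (⟦ L ⟧ ⊗ ⟦ P ⟧) p j  ≈⟨ *-congˡ (LP≋PD p j) ⟩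
    ι S s * (⟦ P ⟧ ⊗ D) p j      ≈⟨ *-congˡ (⊗-diagonalʳ D-diag ⟦ P ⟧ p j) ⟩
    ι S s * (ι S s * D j j)      ≈⟨ *-assoc (ι S s) (ι S s) (D j j) ⟨
    ι S s * ι S s * D j j        ≈⟨ *-congʳ (ι-homo-* s s) ⟨
    ι S (s ℤ.* s) * D j j        ≡⟨ cong (λ x → ι S x * D j j) s²≡1 ⟩
    (1# + 0#) * D j j            ≈⟨ *-congʳ (+-identityʳ 1#) ⟩
    1# * D j j                   ≈⟨ *-identityˡ (D j j) ⟩
    D j j                        ∎)
    where
    open import Relation.Binary.Reasoning.Setoid setoid
    s : ℤ
    s = P p j

  column-nonzero : ¬ (1# ≈ 0#) → ∀ {n} {I : Matrix n} (Q : Matrix n) (P : Mat ℤ n) →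
    IsIdentity I → Q ⊗ ⟦ P ⟧ ≋ᴹ I → ∀ j → ∃ λ p → P p j ≢ + 0
  column-nonzero 1≉0 {n} {I} Q P (_ , I≈1) QP≋I j =
    ¬∀⟶∃¬ n (λ p → P p j ≡ + 0) (λ p → P p j ℤ.≟ + 0) λ column≡0 → 1≉0 (begin
      1#                ≈⟨ I≈1 j ⟨
      I j j             ≈⟨ QP≋I j j ⟨
      (Q ⊗ ⟦ P ⟧) j j   ≈⟨ sum-zero _ (λ p → trans (*-congˡ (reflexive (cong (ι S) (column≡0 p))))
                                                   (zeroʳ (Q j p))) ⟩
      0#                ∎)
    where open import Relation.Binary.Reasoning.Setoid setoid

-- What remains of a diagonalization P⁻¹ L P once the denominators of P⁻¹ are cleared;
-- unlike P⁻¹ it makes sense in any ring.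
record IntegralEigenbasis {n} (L : Mat ℤ n) : Set where
  field
    Q          : Mat ℤ n
    eigenvalue : Fin n → ℤ
    Q-eigen    : ∀ j k → (Q ·ℤ L) j k ≡ eigenvalue j ℤ.* Q j k
    P          : Mat ℤ n
    m          : ℕ
    PQ-diag    : ∀ i → (P ·ℤ Q) i i ≡ + suc m
    PQ-off     : ∀ i k → i ≢ k → (P ·ℤ Q) i k ≡ + 0

module Rationals where
  ℚ-ring : CommutativeRing 0ℓ 0ℓ
  ℚ-ring = ℚ.+-*-commutativeRing

  open Sums ℚ-ring
  open IntegerEmbedding ℚ-ring
  open Matrices ℚ-ring
  open Diagonalization ℚ-ring
  open ≡-Reasoning

  fromℤ-homo-+ : ∀ i j → fromℤ (i ℤ.+ j) ≡ fromℤ i ℚ.+ fromℤ j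
  fromℤ-homo-+ i j = ℚ.toℚᵘ-injective (ℚᵘ.≃-sym (ℚᵘ.≃-trans (ℚ.toℚᵘ-homo-+ (fromℤ i) (fromℤ j))
    (ℚᵘ.*≡* (≡.trans (ℤ.*-identityʳ _)
      (≡.trans (≡.cong₂ ℤ._+_ (ℤ.*-identityʳ i) (ℤ.*-identityʳ j)) (≡.sym (ℤ.*-identityʳ (i ℤ.+ j))))))))

  fromℤ≡ιℕ : ∀ m → fromℤ (+ m) ≡ ιℕ ℚ-ring m
  fromℤ≡ιℕ zero    = ≡.refl
  fromℤ≡ιℕ (suc m) = ≡.trans (fromℤ-homo-+ (+ 1) (+ m)) (cong (λ x → ℚ.1ℚ ℚ.+ x) (fromℤ≡ιℕ m))

  fromℤ≡ι : ∀ z → fromℤ z ≡ ι ℚ-ring z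
  fromℤ≡ι (+ m)    = fromℤ≡ιℕ m
  fromℤ≡ι -[1+ m ] = cong ℚ.-_ (fromℤ≡ιℕ (suc m))

  ι-injective : ∀ {i j} → ι ℚ-ring i ≡ ι ℚ-ring j → i ≡ j
  ι-injective {i} {j} ιi≡ιj =
    cong ℚ.numerator (≡.trans (fromℤ≡ι i) (≡.trans ιi≡ιj (≡.sym (fromℤ≡ι j))))

  toℚ≋⟦⟧ : ∀ {n} (M : Mat ℤ n) → toℚ M ≋ᴹ ⟦ M ⟧
  toℚ≋⟦⟧ M i j = ≡.trans (ℚ.↥p/↧p≡p (fromℤ (M i j))) (fromℤ≡ι (M i j))

  sumℚ≡sum : ∀ {n} (f : Vector ℚ n) → sumℚ f ≡ sum f
  sumℚ≡sum {zero}  f = ≡.refl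
  sumℚ≡sum {suc n} f = cong (λ s → f zero ℚ.+ s) (sumℚ≡sum (f ∘ suc))

  ·ℚ≋⊗ : ∀ {n} (A B : Mat ℚ n) → A ·ℚ B ≋ᴹ A ⊗ B
  ·ℚ≋⊗ A B i k = sumℚ≡sum λ j → A i j ℚ.* B j k

  ·ℚ-toℚ≋⊗ : ∀ {n} (A : Mat ℚ n) (B : Mat ℤ n) → A ·ℚ toℚ B ≋ᴹ A ⊗ ⟦ B ⟧
  ·ℚ-toℚ≋⊗ A B = ≋ᴹ.trans (·ℚ≋⊗ A (toℚ B)) (⊗-congˡ A (toℚ≋⟦⟧ B))

  toℚ-·ℚ≋⊗ : ∀ {n} (A : Mat ℤ n) (B : Mat ℚ n) → toℚ A ·ℚ B ≋ᴹ ⟦ A ⟧ ⊗ B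
  toℚ-·ℚ≋⊗ A B = ≋ᴹ.trans (·ℚ≋⊗ (toℚ A) B) (⊗-congʳ B (toℚ≋⟦⟧ A))

  idℚ-isIdentity : ∀ {n} → IsIdentity (idℚ {n})
  idℚ-isIdentity = (λ i j i≢j → δ-off ℚ.1ℚ ℚ.0ℚ i≢j) , δ-diag ℚ.1ℚ ℚ.0ℚ

  ClearsDenominator : ℕ → ℚ → Set
  ClearsDenominator N q = ∃ λ z → ι ℚ-ring z ≡ ιℕ ℚ-ring N ℚ.* q

  denominator-clears : ∀ q → ClearsDenominator (suc (ℚ.denominator-1 q)) q
  denominator-clears q@(mkℚ num d _) = num , (begin
    ι ℚ-ring num               ≡⟨ fromℤ≡ι num ⟨
    fromℤ num                  ≡⟨ num≡den*q ⟩
    fromℤ (+ suc d) ℚ.* q      ≡⟨ cong (ℚ._* q) (fromℤ≡ι (+ suc d)) ⟩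
    ιℕ ℚ-ring (suc d) ℚ.* q    ∎)
    where
    num≡den*q : fromℤ num ≡ fromℤ (+ suc d) ℚ.* q
    num≡den*q = ℚ.toℚᵘ-injective (ℚᵘ.≃-sym (ℚᵘ.≃-trans (ℚ.toℚᵘ-homo-* (fromℤ (+ suc d)) q)
      (ℚᵘ.*≡* (≡.trans (ℤ.*-identityʳ _)
        (≡.trans (ℤ.*-comm (+ suc d) num) (cong (num ℤ.*_) (≡.sym (ℤ.*-identityˡ (+ suc d)))))))))

  multiple-clears : ∀ M {N q} → ClearsDenominator N q → ClearsDenominator (M ℕ.* N) q
  multiple-clears M {N} {q} (z , ιz≡Nq) = + M ℤ.* z , (begin
    ι ℚ-ring (+ M ℤ.* z)                   ≡⟨ ι-homo-* (+ M) z ⟩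
    ιℕ ℚ-ring M ℚ.* ι ℚ-ring z             ≡⟨ cong (ιℕ ℚ-ring M ℚ.*_) ιz≡Nq ⟩
    ιℕ ℚ-ring M ℚ.* (ιℕ ℚ-ring N ℚ.* q)    ≡⟨ ℚ.*-assoc (ιℕ ℚ-ring M) (ιℕ ℚ-ring N) q ⟨
    ιℕ ℚ-ring M ℚ.* ιℕ ℚ-ring N ℚ.* q      ≡⟨ cong (ℚ._* q) (ιℕ-homo-* M N) ⟨
    ιℕ ℚ-ring (M ℕ.* N) ℚ.* q              ∎)

  clear-denominators : ∀ {n} (Q : Mat ℚ n) →
    ∃ λ m → ∃ λ (Q′ : Mat ℤ n) → ⟦ Q′ ⟧ ≋ᴹ ιℕ ℚ-ring (suc m) ·ᴹ Q
  clear-denominators Q with common-multiple (λ j N → ∀ k → ClearsDenominator N (Q j k))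
    (λ j M clears k → multiple-clears M (clears k))
    (λ j → common-multiple (λ k N → ClearsDenominator N (Q j k)) (λ k M → multiple-clears M)
             (λ k → ℚ.denominator-1 (Q j k) , denominator-clears (Q j k)))
  ... | m , clears = m , (λ j k → proj₁ (clears j k)) , (λ j k → proj₂ (clears j k))

  signed-diagonalization⇒eigenbasis : ∀ {n} (L P : Mat ℤ n) →
    (∀ i j → P i j ≡ + 0 ⊎ P i j ≡ + 1 ⊎ P i j ≡ ℤ.- (+ 1)) →
    (Q : Mat ℚ n) → Q ·ℚ toℚ P ≡ idℚ → toℚ P ·ℚ Q ≡ idℚ →
    IsDiagonalℚ ((Q ·ℚ toℚ L) ·ℚ toℚ P) → IntegralEigenbasis L
  signed-diagonalization⇒eigenbasis {n} L P entries Q QP≡I PQ≡I QLP-diag = record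
    { Q = Q′ ; eigenvalue = d ; Q-eigen = Q′L≡dQ′
    ; P = P  ; m = m          ; PQ-diag = PQ′-diag ; PQ-off = PQ′-off
    }
    where
    QP≋I : Q ⊗ ⟦ P ⟧ ≋ᴹ idℚ
    QP≋I i k = ≡.trans (≡.sym (·ℚ-toℚ≋⊗ Q P i k)) (cong (λ M → M i k) QP≡I)

    PQ≋I : ⟦ P ⟧ ⊗ Q ≋ᴹ idℚ
    PQ≋I i k = ≡.trans (≡.sym (toℚ-·ℚ≋⊗ P Q i k)) (cong (λ M → M i k) PQ≡I)

    D : Matrix n
    D = Q ⊗ ⟦ L ⟧ ⊗ ⟦ P ⟧

    D-diag : IsDiagonal D
    D-diag i j i≢j = ≡.trans D≡QLP (QLP-diag i j i≢j)
      where
      D≡QLP : D i j ≡ ((Q ·ℚ toℚ L) ·ℚ toℚ P) i j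
      D≡QLP = ≡.sym (≋ᴹ.trans (·ℚ-toℚ≋⊗ (Q ·ℚ toℚ L) P) (⊗-congʳ ⟦ P ⟧ (·ℚ-toℚ≋⊗ Q L)) i j)

    column : ∀ j → ∃ λ p → P p j ≢ + 0
    column = column-nonzero (λ ()) Q P idℚ-isIdentity QP≋I

    d : Fin n → ℤ
    d j = P p j ℤ.* (L ·ℤ P) p j
      where
      p : Fin n
      p = proj₁ (column j)

    D≡d : ∀ j → D j j ≡ ι ℚ-ring (d j)
    D≡d j = diagonal-entry-integral L P D-diag (intertwineʳ idℚ-isIdentity PQ≋I ⟦ L ⟧)
      (unit-square (entries (proj₁ (column j)) j) (proj₂ (column j)))

    m : ℕ
    m = proj₁ (clear-denominators Q)

    N : ℚ
    N = ιℕ ℚ-ring (suc m)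

    Q′ : Mat ℤ n
    Q′ = proj₁ (proj₂ (clear-denominators Q))

    Q′≋NQ : ⟦ Q′ ⟧ ≋ᴹ N ·ᴹ Q
    Q′≋NQ = proj₂ (proj₂ (clear-denominators Q))

    Q′L≡dQ′ : ∀ j k → (Q′ ·ℤ L) j k ≡ d j ℤ.* Q′ j k
    Q′L≡dQ′ j k = ι-injective (begin
      ι ℚ-ring ((Q′ ·ℤ L) j k)               ≡⟨ ⟦⟧-homo-⊗ Q′ L j k ⟩
      (⟦ Q′ ⟧ ⊗ ⟦ L ⟧) j k                   ≡⟨ ⊗-congʳ ⟦ L ⟧ Q′≋NQ j k ⟩
      (N ·ᴹ Q ⊗ ⟦ L ⟧) j k                   ≡⟨ ·ᴹ-⊗ N Q ⟦ L ⟧ j k ⟩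
      N ℚ.* (Q ⊗ ⟦ L ⟧) j k                  ≡⟨ cong (N ℚ.*_) (intertwineˡ idℚ-isIdentity PQ≋I ⟦ L ⟧ j k) ⟩
      N ℚ.* (D ⊗ Q) j k                      ≡⟨ cong (N ℚ.*_) (⊗-diagonalˡ D-diag Q j k) ⟩
      N ℚ.* (D j j ℚ.* Q j k)                ≡⟨ x∙yz≈y∙xz N (D j j) (Q j k) ⟩
      D j j ℚ.* (N ℚ.* Q j k)                ≡⟨ ≡.cong₂ ℚ._*_ (D≡d j) (≡.sym (Q′≋NQ j k)) ⟩
      ι ℚ-ring (d j) ℚ.* ι ℚ-ring (Q′ j k)   ≡⟨ ι-homo-* (d j) (Q′ j k) ⟨
      ι ℚ-ring (d j ℤ.* Q′ j k)              ∎)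
      where
      open import Algebra.Properties.CommutativeSemigroup
        (CommutativeRing.*-commutativeSemigroup ℚ-ring) using (x∙yz≈y∙xz)

    PQ′≡NI : ∀ i k → ι ℚ-ring ((P ·ℤ Q′) i k) ≡ N ℚ.* idℚ i k
    PQ′≡NI i k = begin
      ι ℚ-ring ((P ·ℤ Q′) i k)   ≡⟨ ⟦⟧-homo-⊗ P Q′ i k ⟩
      (⟦ P ⟧ ⊗ ⟦ Q′ ⟧) i k       ≡⟨ ⊗-congˡ ⟦ P ⟧ Q′≋NQ i k ⟩
      (⟦ P ⟧ ⊗ N ·ᴹ Q) i k       ≡⟨ ⊗-·ᴹ N ⟦ P ⟧ Q i k ⟩
      N ℚ.* (⟦ P ⟧ ⊗ Q) i k      ≡⟨ cong (N ℚ.*_) (PQ≋I i k) ⟩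
      N ℚ.* idℚ i k              ∎

    PQ′-diag : ∀ i → (P ·ℤ Q′) i i ≡ + suc m
    PQ′-diag i = ι-injective (≡.trans (PQ′≡NI i i)
      (≡.trans (cong (N ℚ.*_) (δ-diag ℚ.1ℚ ℚ.0ℚ i)) (ℚ.*-identityʳ N)))

    PQ′-off : ∀ i k → i ≢ k → (P ·ℤ Q′) i k ≡ + 0
    PQ′-off i k i≢k = ι-injective (≡.trans (PQ′≡NI i k)
      (≡.trans (cong (N ℚ.*_) (δ-off ℚ.1ℚ ℚ.0ℚ i≢k)) (ℚ.*-zeroʳ N)))

module Eigenvalues {c ℓ} (R : CommutativeRing c ℓ)
  (domain : IsIntegralDomain R) (char0 : HasCharZero R) where
  open CommutativeRing R hiding (zero)
  open Sums R
  open IntegerEmbedding R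
  open Matrices R
  open import Algebra.Properties.Ring ring using ([y-z]x≈yx-zx)
  open GroupProperties +-group using (x∙y⁻¹≈ε⇒x≈y)
  open import Relation.Binary.Reasoning.Setoid setoid

  *-cancelʳ-or-zero : ∀ x y z → x * z ≈ y * z → x ≈ y ⊎ z ≈ 0#
  *-cancelʳ-or-zero x y z xz≈yz =
    Sum.map₁ (x∙y⁻¹≈ε⇒x≈y x y) (proj₂ domain (x - y) z (begin
      (x - y) * z      ≈⟨ [y-z]x≈yx-zx z x y ⟩
      x * z - y * z    ≈⟨ +-congʳ xz≈yz ⟩
      y * z - y * z    ≈⟨ -‿inverseʳ (y * z) ⟩
      0#               ∎))

  eigenvalue∈eigenbasis : ∀ {n} {L : Mat ℤ n} (B : IntegralEigenbasis L) →
    ∀ λ′ → IsEigenvalue R L λ′ → ∃ λ j → λ′ ≈ ι R (IntegralEigenbasis.eigenvalue B j)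
  eigenvalue∈eigenbasis {n} {L} B λ′ (v , (i₀ , v≉0) , Lv≈λv) =
    Sum.[ id , ⊥-elim ∘ w≉0 ] (∀⊎⇒∃⊎∀ eigen-or-zero)
    where
    open IntegralEigenbasis B

    w : Vector Carrier n
    w = ⟦ Q ⟧ ⊛ v

    Lv≈λ′v : ∀ i → (⟦ L ⟧ ⊛ v) i ≈ λ′ * v i
    Lv≈λ′v i = trans (reflexive (≡.sym (sumR≡sum λ j → ι R (L i j) * v j))) (Lv≈λv i)

    QL≈dQ : ∀ j k → (⟦ Q ⟧ ⊗ ⟦ L ⟧) j k ≈ ι R (eigenvalue j) * ⟦ Q ⟧ j k
    QL≈dQ j k = begin
      (⟦ Q ⟧ ⊗ ⟦ L ⟧) j k              ≈⟨ ⟦⟧-homo-⊗ Q L j k ⟨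
      ι R ((Q ·ℤ L) j k)               ≡⟨ cong (ι R) (Q-eigen j k) ⟩
      ι R (eigenvalue j ℤ.* Q j k)     ≈⟨ ι-homo-* (eigenvalue j) (Q j k) ⟩
      ι R (eigenvalue j) * ι R (Q j k) ∎

    w-eigen : ∀ j → ι R (eigenvalue j) * w j ≈ λ′ * w j
    w-eigen j = begin
      ι R (eigenvalue j) * w j       ≈⟨ ⊛-row-* (⟦ Q ⟧ ⊗ ⟦ L ⟧) ⟦ Q ⟧ _ v j (QL≈dQ j) ⟨
      ((⟦ Q ⟧ ⊗ ⟦ L ⟧) ⊛ v) j        ≈⟨ ⊛-assoc ⟦ Q ⟧ ⟦ L ⟧ v j ⟩
      (⟦ Q ⟧ ⊛ (⟦ L ⟧ ⊛ v)) j        ≈⟨ ⊛-congʳ ⟦ Q ⟧ Lv≈λ′v j ⟩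
      (⟦ Q ⟧ ⊛ (λ k → λ′ * v k)) j   ≈⟨ ⊛-*ʳ λ′ ⟦ Q ⟧ v j ⟩
      λ′ * w j                       ∎

    eigen-or-zero : ∀ j → λ′ ≈ ι R (eigenvalue j) ⊎ w j ≈ 0#
    eigen-or-zero j = Sum.map₁ sym (*-cancelʳ-or-zero _ _ (w j) (w-eigen j))

    Pw≈Nv : (⟦ P ⟧ ⊛ w) i₀ ≈ ιℕ R (suc m) * v i₀
    Pw≈Nv = begin
      (⟦ P ⟧ ⊛ (⟦ Q ⟧ ⊛ v)) i₀         ≈⟨ ⊛-assoc ⟦ P ⟧ ⟦ Q ⟧ v i₀ ⟨
      ((⟦ P ⟧ ⊗ ⟦ Q ⟧) ⊛ v) i₀         ≈⟨ ⊛-congˡ (⟦⟧-homo-⊗ P Q) v i₀ ⟨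
      (⟦ P ·ℤ Q ⟧ ⊛ v) i₀              ≈⟨ sum-single i₀ _ off-diagonal≈0 ⟩
      ι R ((P ·ℤ Q) i₀ i₀) * v i₀      ≡⟨ cong (λ x → ι R x * v i₀) (PQ-diag i₀) ⟩
      ιℕ R (suc m) * v i₀              ∎
      where
      off-diagonal≈0 : ∀ k → i₀ ≢ k → ι R ((P ·ℤ Q) i₀ k) * v k ≈ 0#
      off-diagonal≈0 k i₀≢k =
        trans (*-congʳ (reflexive (cong (ι R) (PQ-off i₀ k i₀≢k)))) (zeroˡ (v k))

    w≉0 : ¬ (∀ j → w j ≈ 0#)
    w≉0 w≈0 = Sum.[ char0 m , v≉0 ] (proj₂ domain (ιℕ R (suc m)) (v i₀) (begin
      ιℕ R (suc m) * v i₀   ≈⟨ Pw≈Nv ⟨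
      (⟦ P ⟧ ⊛ w) i₀        ≈⟨ sum-zero _ (λ j → trans (*-congˡ (w≈0 j)) (zeroʳ (ι R (P i₀ j)))) ⟩
      0#                    ∎))

theorem3p1 : ∀ {c ℓ} (R : CommutativeRing c ℓ) → IsIntegralDomain R → HasCharZero R →
    ∀ {n : ℕ} (X : IntWeightedGraph n) → WHD X →
      ∀ (λ′ : CommutativeRing.Carrier R) → IsEigenvalue R (laplacian X) λ′ →
        Σ ℤ (λ z → CommutativeRing._≈_ R λ′ (ι R z))
theorem3p1 R domain char0 X (P , (entries , _) , Q , QP≡I , PQ≡I , QLP-diag) λ′ λ′-eigen =
  Product.map (IntegralEigenbasis.eigenvalue B) id
    (Eigenvalues.eigenvalue∈eigenbasis R domain char0 B λ′ λ′-eigen)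
  where
  B : IntegralEigenbasis (laplacian X)
  B = Rationals.signed-diagonalization⇒eigenbasis (laplacian X) P entries Q QP≡I PQ≡I QLP-diag
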